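{- Let $G$ be any access graph. Assume that for every request sequence $I$ respecting $G$ for which there exists a worst ordering $I_{\mathrm{LRU}}\in W(I,G,\mathrm{LRU})$ having no two consecutive requests to the same page, we have $\mathrm{LRU}(I_{\mathrm{LRU}})\le \mathrm{FIFO}^G_W(I)$. Then for every request sequence $I$ respecting $G$, $\mathrm{LRU}^G_W(I)\le \mathrm{FIFO}^G_W(I)$.
   Context: Paging: a cache of size $k\ge1$, initially empty; on a request to a page not in cache (a fault) the page is brought in, evicting a page if the cache is full; $\mathrm{A}(I)$ is the number of faults of algorithm $\mathrm{A}$ on $I$. LRU evicts the least recently requested page in cache; FIFO evicts the page that has been in cache the longest. An access graph is an undirected graph whose vertices are the pages; a sequence respects it if any two consecutive requests are to the same page or to adjacent vertices. For an algorithm $\mathrm{A}$ and access graph $G$, $\mathrm{A}^G_W(I)=\max_\sigma \mathrm{A}(\sigma(I))$ over all permutations $\sigma$ of the requests of $I$ such that $\sigma(I)$ respects $G$. $W(I,G,\mathrm{A})$ denotes the set of permutations $J$ of $I$ that respect $G$ and satisfy $\mathrm{A}(J)=\mathrm{A}^G_W(I)$. -}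

module Defs where

open import Data.Nat using (ℕ; zero; suc; _+_; _≤_; _<?_; _≟_)
open import Data.List using (List; []; _∷_; length; filter; reverse; drop; take)
open import Data.List.Relation.Binary.Permutation.Propositional using (_↭_)
open import Data.List.Membership.DecPropositional _≟_ using (_∈?_)
open import Data.Product using (Σ; _×_; ∃)
open import Data.Sum using (_⊎_)
open import Relation.Nullary using (¬_; yes; no; ¬?)
open import Relation.Binary.PropositionalEquality using (_≡_)

Page : Set
Page = ℕ

record AccessGraph : Set₁ where
  field
    Adj : Page → Page → Set
    sym : ∀ {p q} → Adj p q → Adj q p
open AccessGraph public

data Respects (G : AccessGraph) : List Page → Set where
  []-resp : Respects G []
  [-]-resp : ∀ p → Respects G (p ∷ [])
  ∷-resp : ∀ {p q rest} → (p ≡ q ⊎ Adj G p q) →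
           Respects G (q ∷ rest) → Respects G (p ∷ q ∷ rest)

data NoConsecRepeat : List Page → Set where
  []-ncr : NoConsecRepeat []
  [-]-ncr : ∀ p → NoConsecRepeat (p ∷ [])
  ∷-ncr : ∀ {p q rest} → ¬ (p ≡ q) →
          NoConsecRepeat (q ∷ rest) → NoConsecRepeat (p ∷ q ∷ rest)

remove : Page → List Page → List Page
remove p = filter (λ q → ¬? (q ≟ p))

dropLast : List Page → List Page
dropLast [] = []
dropLast (_ ∷ []) = []
dropLast (x ∷ y ∷ xs) = x ∷ dropLast (y ∷ xs)

-- Cache of size k, represented as a list with the "freshest" page first
-- (most recently requested for LRU, most recently loaded for FIFO);
-- the eviction victim is the last element.
lruRun : ℕ → List Page → List Page → ℕ
lruRun k cache [] = 0
lruRun k cache (p ∷ ps) with p ∈? cache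
... | yes _ = lruRun k (p ∷ remove p cache) ps
... | no _ with length cache <? k
...   | yes _ = suc (lruRun k (p ∷ cache) ps)
...   | no _  = suc (lruRun k (p ∷ dropLast cache) ps)

fifoRun : ℕ → List Page → List Page → ℕ
fifoRun k cache [] = 0
fifoRun k cache (p ∷ ps) with p ∈? cache
... | yes _ = fifoRun k cache ps
... | no _ with length cache <? k
...   | yes _ = suc (fifoRun k (p ∷ cache) ps)
...   | no _  = suc (fifoRun k (p ∷ dropLast cache) ps)

LRU : ℕ → List Page → ℕ
LRU k = lruRun k []

FIFO : ℕ → List Page → ℕ
FIFO k = fifoRun k []

Algorithm : Set
Algorithm = List Page → ℕ

InW : AccessGraph → Algorithm → List Page → List Page → Set
InW G A I J = (J ↭ I) × Respects G J ×
              (∀ J′ → J′ ↭ I → Respects G J′ → A J′ ≤ A J)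

IsWorstValue : AccessGraph → Algorithm → List Page → ℕ → Set
IsWorstValue G A I m =
  Σ (List Page) (λ J → (J ↭ I) × Respects G J × A J ≡ m) ×
  (∀ J′ → J′ ↭ I → Respects G J′ → A J′ ≤ m)

-- Requesting the page just requested is a hit for both LRU and
-- FIFO and leaves the cache unchanged, so collapsing runs of equal
-- consecutive requests changes neither cost ("stuttering invariance").
-- Take a worst LRU ordering J of I and let D = dedup J be J with repeats
-- collapsed.  Conversely, the collapsed requests can be reinserted into
-- ANY ordering of D respecting G, each right after an occurrence of the
-- same page, giving an ordering of I respecting G with the same LRU and
-- FIFO costs.  Hence D is a worst LRU ordering of itself, LRU(D) = LRU(J),
-- and FIFO^G_W(D) ≤ FIFO^G_W(I).  The hypothesis, applied to the instance
-- D, gives LRU(D) ≤ FIFO^G_W(D), and the chain closes.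
--
-- The value FIFO^G_W(D) is a maximum over a set we never enumerate; its
-- existence is only shown under double negation (a bounded inhabited set
-- of naturals has a maximum), which suffices because the goal mL ≤ mF is
-- decidable and hence stable.
module Submission where

open import Defs hiding (sym)
open import Data.Nat using (ℕ; zero; suc; _≤_; _<?_; _≟_; _≤?_; z≤n; s≤s)
open import Data.Nat.Properties using (≤-trans; ≤-reflexive; n≤1+n; ≤-pred; m≤n⇒m<n∨m≡n; n≤0⇒n≡0; module ≤-Reasoning)
open import Data.List using (List; []; _∷_; length; _++_)
open import Data.List.Relation.Unary.All as All using (All; []; _∷_)
open import Data.List.Relation.Unary.Any using (here; there)
open import Data.List.Membership.Propositional using (_∈_; _∉_)
open import Data.List.Membership.Propositional.Properties using (∈-∃++; ∈-++⁺ʳ; ∈-filter⁻)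
open import Data.List.Membership.DecPropositional _≟_ using (_∈?_)
open import Data.List.Properties using (filter-all; filter-reject)
open import Data.List.Relation.Binary.Permutation.Propositional using (_↭_; prep; ↭-sym; ↭-trans; ↭-refl)
open import Data.List.Relation.Binary.Permutation.Propositional.Properties using (∈-resp-↭; ↭-length; ++⁺ˡ; shift)
open import Data.Product using (Σ; ∃; _×_; _,_; proj₂)
open import Data.Sum using (inj₁; inj₂)
open import Relation.Nullary using (¬_; yes; no; ¬?; contradiction)
open import Relation.Nullary.Decidable using (decidable-stable; ¬¬-excluded-middle)
open import Relation.Binary.PropositionalEquality using (_≡_; refl; sym; trans; cong; subst)

-- Collapsing runs of equal consecutive requests.  'collapse x xs' is what
-- follows the first request x in the collapsed form of x ∷ xs, and
-- 'collapsed x xs' lists the requests that were dropped.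

collapse : Page → List Page → List Page
collapse x []       = []
collapse x (y ∷ ys) with x ≟ y
... | yes _ = collapse x ys
... | no  _ = y ∷ collapse y ys

collapsed : Page → List Page → List Page
collapsed x []       = []
collapsed x (y ∷ ys) with x ≟ y
... | yes _ = y ∷ collapsed x ys
... | no  _ = collapsed y ys

dedup : List Page → List Page
dedup []       = []
dedup (x ∷ xs) = x ∷ collapse x xs

repeats : List Page → List Page
repeats []       = []
repeats (x ∷ xs) = collapsed x xs

collapse-noRepeat : ∀ x xs → NoConsecRepeat (x ∷ collapse x xs)
collapse-noRepeat x []       = [-]-ncr x
collapse-noRepeat x (y ∷ ys) with x ≟ y
... | yes _   = collapse-noRepeat x ys
... | no  x≢y = ∷-ncr x≢y (collapse-noRepeat y ys)

dedup-noRepeat : ∀ J → NoConsecRepeat (dedup J)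
dedup-noRepeat []       = []-ncr
dedup-noRepeat (x ∷ xs) = collapse-noRepeat x xs

-- Collapsing only deletes the second of two equal neighbours, so every
-- remaining consecutive pair was already consecutive or equal.
collapse-respects : ∀ {G} x xs → Respects G (x ∷ xs) → Respects G (x ∷ collapse x xs)
collapse-respects x []       r = r
collapse-respects x (y ∷ ys) (∷-resp x~y r) with x ≟ y
... | yes refl = collapse-respects x ys r
... | no  _    = ∷-resp x~y (collapse-respects y ys r)

dedup-respects : ∀ {G} J → Respects G J → Respects G (dedup J)
dedup-respects []       r = r
dedup-respects (x ∷ xs) r = collapse-respects x xs r

collapse-↭ : ∀ x xs → x ∷ xs ↭ collapsed x xs ++ x ∷ collapse x xs
collapse-↭ x []       = ↭-refl
collapse-↭ x (y ∷ ys) with x ≟ y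
... | yes refl = prep x (collapse-↭ x ys)
... | no  _    = ↭-trans (prep x (collapse-↭ y ys))
                         (↭-sym (shift x (collapsed y ys) (y ∷ collapse y ys)))

dedup-↭ : ∀ J → J ↭ repeats J ++ dedup J
dedup-↭ []       = ↭-refl
dedup-↭ (x ∷ xs) = collapse-↭ x xs

collapsed⊆collapse : ∀ x xs → All (_∈ x ∷ collapse x xs) (collapsed x xs)
collapsed⊆collapse x []       = []
collapsed⊆collapse x (y ∷ ys) with x ≟ y
... | yes refl = here refl ∷ collapsed⊆collapse x ys
... | no  _    = All.map there (collapsed⊆collapse y ys)

repeats⊆dedup : ∀ J → All (_∈ dedup J) (repeats J)
repeats⊆dedup []       = []
repeats⊆dedup (x ∷ xs) = collapsed⊆collapse x xs

respects-stutter : ∀ {G} xs p ys → Respects G (xs ++ p ∷ ys) → Respects G (xs ++ p ∷ p ∷ ys)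
respects-stutter []           p ys r              = ∷-resp (inj₁ refl) r
respects-stutter (x ∷ [])     p ys (∷-resp x~p r) = ∷-resp x~p (respects-stutter [] p ys r)
respects-stutter (x ∷ y ∷ xs) p ys (∷-resp x~y r) = ∷-resp x~y (respects-stutter (y ∷ xs) p ys r)

-- Cache lemmas: after p is requested the cache is  p ∷ X  with p ∉ X.

remove-∉ : ∀ p X → p ∉ X → remove p X ≡ X
remove-∉ p X p∉X = filter-all (λ q → ¬? (q ≟ p)) (others X p∉X)
  where
  others : ∀ X → p ∉ X → All (λ q → ¬ q ≡ p) X
  others []      _    = []
  others (x ∷ X) p∉xX = (λ x≡p → p∉xX (here (sym x≡p))) ∷ others X (λ p∈X → p∉xX (there p∈X))

∉-remove : ∀ p X → p ∉ remove p X
∉-remove p X p∈ = proj₂ (∈-filter⁻ (λ q → ¬? (q ≟ p)) {xs = X} p∈) refl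

∉-dropLast : ∀ p X → p ∉ X → p ∉ dropLast X
∉-dropLast p (x ∷ y ∷ X) p∉ (here p≡x) = p∉ (here p≡x)
∉-dropLast p (x ∷ y ∷ X) p∉ (there p∈) = ∉-dropLast p (y ∷ X) (λ p∈′ → p∉ (there p∈′)) p∈

lru-refresh-head : ∀ p X → p ∉ X → p ∷ remove p (p ∷ X) ≡ p ∷ X
lru-refresh-head p X p∉X =
  cong (p ∷_) (trans (filter-reject (λ q → ¬? (q ≟ p)) (λ p≢p → p≢p refl)) (remove-∉ p X p∉X))

module Costs (k : ℕ) where

  lru-hit : ∀ {p c} ys → p ∈ c → lruRun k c (p ∷ ys) ≡ lruRun k (p ∷ remove p c) ys
  lru-hit {p} {c} ys p∈c with p ∈? c
  ... | yes _   = refl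
  ... | no  p∉c = contradiction p∈c p∉c

  fifo-hit : ∀ {p c} ys → p ∈ c → fifoRun k c (p ∷ ys) ≡ fifoRun k c ys
  fifo-hit {p} {c} ys p∈c with p ∈? c
  ... | yes _   = refl
  ... | no  p∉c = contradiction p∈c p∉c

  lru-stutter : ∀ p ys c → lruRun k c (p ∷ p ∷ ys) ≡ lruRun k c (p ∷ ys)
  lru-stutter p ys c with p ∈? c
  ... | yes _ = trans (lru-hit ys (here refl))
                      (cong (λ c′ → lruRun k c′ ys) (lru-refresh-head p _ (∉-remove p c)))
  ... | no p∉c with length c <? k
  ...   | yes _ = cong suc (trans (lru-hit ys (here refl))
                                  (cong (λ c′ → lruRun k c′ ys) (lru-refresh-head p c p∉c)))
  ...   | no  _ = cong suc (trans (lru-hit ys (here refl))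
                                  (cong (λ c′ → lruRun k c′ ys) (lru-refresh-head p _ (∉-dropLast p c p∉c))))

  fifo-stutter : ∀ p ys c → fifoRun k c (p ∷ p ∷ ys) ≡ fifoRun k c (p ∷ ys)
  fifo-stutter p ys c with p ∈? c
  ... | yes p∈c = fifo-hit ys p∈c
  ... | no  _ with length c <? k
  ...   | yes _ = cong suc (fifo-hit ys (here refl))
  ...   | no  _ = cong suc (fifo-hit ys (here refl))

  fifo≤length : ∀ c J → fifoRun k c J ≤ length J
  fifo≤length c []      = z≤n
  fifo≤length c (p ∷ J) with p ∈? c
  ... | yes _ = ≤-trans (fifo≤length c J) (n≤1+n _)
  ... | no  _ with length c <? k
  ...   | yes _ = s≤s (fifo≤length _ J)
  ...   | no  _ = s≤s (fifo≤length _ J)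

  record SameCost (X Y : List Page) : Set where
    constructor sameCost
    field
      lru-cost  : ∀ c → lruRun k c X ≡ lruRun k c Y
      fifo-cost : ∀ c → fifoRun k c X ≡ fifoRun k c Y
  open SameCost public

  sameCost-refl : ∀ X → SameCost X X
  sameCost-refl X = sameCost (λ _ → refl) (λ _ → refl)

  sameCost-trans : ∀ {X Y Z} → SameCost X Y → SameCost Y Z → SameCost X Z
  sameCost-trans (sameCost l₁ f₁) (sameCost l₂ f₂) =
    sameCost (λ c → trans (l₁ c) (l₂ c)) (λ c → trans (f₁ c) (f₂ c))

  sameCost-stutter : ∀ p ys → SameCost (p ∷ p ∷ ys) (p ∷ ys)
  sameCost-stutter p ys = sameCost (lru-stutter p ys) (fifo-stutter p ys)

  sameCost-∷ : ∀ x {xs ys} → SameCost xs ys → SameCost (x ∷ xs) (x ∷ ys)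
  sameCost-∷ x {xs} {ys} (sameCost l f) = sameCost lru fifo
    where
    lru : ∀ c → lruRun k c (x ∷ xs) ≡ lruRun k c (x ∷ ys)
    lru c with x ∈? c
    ... | yes _ = l _
    ... | no  _ with length c <? k
    ...   | yes _ = cong suc (l _)
    ...   | no  _ = cong suc (l _)
    fifo : ∀ c → fifoRun k c (x ∷ xs) ≡ fifoRun k c (x ∷ ys)
    fifo c with x ∈? c
    ... | yes _ = f _
    ... | no  _ with length c <? k
    ...   | yes _ = cong suc (f _)
    ...   | no  _ = cong suc (f _)

  sameCost-++ : ∀ xs {ys zs} → SameCost ys zs → SameCost (xs ++ ys) (xs ++ zs)
  sameCost-++ []       eq = eq
  sameCost-++ (x ∷ xs) eq = sameCost-∷ x (sameCost-++ xs eq)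

  collapse-sameCost : ∀ x xs → SameCost (x ∷ xs) (x ∷ collapse x xs)
  collapse-sameCost x []       = sameCost-refl (x ∷ [])
  collapse-sameCost x (y ∷ ys) with x ≟ y
  ... | yes refl = sameCost-trans (sameCost-stutter x ys) (collapse-sameCost x ys)
  ... | no  _    = sameCost-∷ x (collapse-sameCost y ys)

  dedup-sameCost : ∀ J → SameCost J (dedup J)
  dedup-sameCost []       = sameCost-refl []
  dedup-sameCost (x ∷ xs) = collapse-sameCost x xs

  Reinsertion : AccessGraph → List Page → List Page → Set
  Reinsertion G R X = Σ (List Page) λ Y → (Y ↭ R ++ X) × Respects G Y × SameCost Y X

  reinsert-one : ∀ {G p X} → p ∈ X → Respects G X → Reinsertion G (p ∷ []) X
  reinsert-one {p = p} p∈X r with ∈-∃++ p∈X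
  ... | xs , ys , refl =
    xs ++ p ∷ p ∷ ys , shift p xs (p ∷ ys) , respects-stutter xs p ys r ,
    sameCost-++ xs (sameCost-stutter p ys)

  reinsert : ∀ {G} R X → All (_∈ X) R → Respects G X → Reinsertion G R X
  reinsert []      X _           r = X , ↭-refl , r , sameCost-refl X
  reinsert (q ∷ R) X (q∈X ∷ R⊆X) r with reinsert R X R⊆X r
  ... | Y′ , Y′↭ , rY′ , costY′ with reinsert-one (∈-resp-↭ (↭-sym Y′↭) (∈-++⁺ʳ R q∈X)) rY′
  ...   | Y , Y↭ , rY , costY = Y , ↭-trans Y↭ (prep q Y′↭) , rY , sameCost-trans costY costY′

  expand : ∀ {G} J J′ → J′ ↭ dedup J → Respects G J′ →
           Σ (List Page) λ Y → (Y ↭ J) × Respects G Y × SameCost Y J′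
  expand J J′ J′↭ rJ′
    with reinsert (repeats J) J′ (All.map (∈-resp-↭ (↭-sym J′↭)) (repeats⊆dedup J)) rJ′
  ... | Y , Y↭ , rY , costY =
    Y , ↭-trans Y↭ (↭-trans (++⁺ˡ (repeats J) J′↭) (↭-sym (dedup-↭ J))) , rY , costY

  dedup-worstLRU : ∀ {G I} J → InW G (LRU k) I J → InW G (LRU k) (dedup J) (dedup J)
  dedup-worstLRU J (J↭I , rJ , J-worst) = ↭-refl , dedup-respects J rJ , dedup-worst
    where
    open ≤-Reasoning
    dedup-worst : ∀ J′ → J′ ↭ dedup J → Respects _ J′ → LRU k J′ ≤ LRU k (dedup J)
    dedup-worst J′ J′↭ rJ′ with expand J J′ J′↭ rJ′
    ... | Y , Y↭J , rY , costY = begin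
      LRU k J′         ≡⟨ sym (lru-cost costY []) ⟩
      LRU k Y          ≤⟨ J-worst Y (↭-trans Y↭J J↭I) rY ⟩
      LRU k J          ≡⟨ lru-cost (dedup-sameCost J) [] ⟩
      LRU k (dedup J)  ∎

  dedup-worstFIFO≤ : ∀ {G I J m mF} → J ↭ I →
    IsWorstValue G (FIFO k) (dedup J) m → IsWorstValue G (FIFO k) I mF → m ≤ mF
  dedup-worstFIFO≤ {J = J} {m} {mF} J↭I ((J′ , J′↭ , rJ′ , FIFOJ′≡m) , _) (_ , I-max)
    with expand J J′ J′↭ rJ′
  ... | Y , Y↭J , rY , costY = begin
    m         ≡⟨ sym FIFOJ′≡m ⟩
    FIFO k J′ ≡⟨ sym (fifo-cost costY []) ⟩
    FIFO k Y  ≤⟨ I-max Y (↭-trans Y↭J J↭I) rY ⟩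
    mF        ∎
    where open ≤-Reasoning

open Costs

¬¬-maximum : (P : ℕ → Set) → ∀ B → (∀ n → P n → n ≤ B) → ∃ P →
             ¬ ¬ (∃ λ m → P m × (∀ n → P n → n ≤ m))
¬¬-maximum P zero    P≤0 (n , Pn) no-max =
  no-max (n , Pn , λ m Pm → subst (m ≤_) (sym (n≤0⇒n≡0 (P≤0 n Pn))) (P≤0 m Pm))
¬¬-maximum P (suc B) P≤B+1 witness no-max = ¬¬-excluded-middle {A = P (suc B)} λ
  { (yes PB+1) → no-max (suc B , PB+1 , P≤B+1)
  ; (no ¬PB+1) → ¬¬-maximum P B (P≤B ¬PB+1) witness no-max }
  where
  P≤B : ¬ P (suc B) → ∀ n → P n → n ≤ B
  P≤B ¬PB+1 n Pn with m≤n⇒m<n∨m≡n (P≤B+1 n Pn)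
  ... | inj₁ n<B+1 = ≤-pred n<B+1
  ... | inj₂ refl  = contradiction Pn ¬PB+1

-- The worst value A^G_W(I) exists (classically) when A faults at most
-- once per request: it is the maximum of a set of attained costs that is
-- bounded by length I and contains A(I).
worstValue-¬¬exists : ∀ G (A : Algorithm) → (∀ J → A J ≤ length J) →
  ∀ I → Respects G I → ¬ ¬ ∃ (IsWorstValue G A I)
worstValue-¬¬exists G A A≤length I rI no-worst =
  ¬¬-maximum Attained (length I) bounded (A I , I , ↭-refl , rI , refl)
    λ (m , attained , maximal) →
      no-worst (m , attained , λ J J↭I rJ → maximal (A J) (J , J↭I , rJ , refl))
  where
  Attained : ℕ → Set
  Attained n = Σ (List Page) λ J → (J ↭ I) × Respects G J × A J ≡ n
  bounded : ∀ n → Attained n → n ≤ length I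
  bounded n (J , J↭I , _ , refl) = ≤-trans (A≤length J) (≤-reflexive (↭-length J↭I))

corollary1 : (k : ℕ) → 1 ≤ k → (G : AccessGraph) →
    (∀ (I : List Page) → Respects G I →
      ∀ (ILRU : List Page) → InW G (LRU k) I ILRU → NoConsecRepeat ILRU →
      ∀ (mF : ℕ) → IsWorstValue G (FIFO k) I mF → LRU k ILRU ≤ mF) →
    ∀ (I : List Page) → Respects G I →
    ∀ (mL mF : ℕ) → IsWorstValue G (LRU k) I mL → IsWorstValue G (FIFO k) I mF →
    mL ≤ mF
corollary1 k _ G hyp I _ mL mF ((J , J↭I , rJ , LRUJ≡mL) , LRU≤mL) worstF =
  decidable-stable (mL ≤? mF) λ mL≰mF →
    worstValue-¬¬exists G (FIFO k) (fifo≤length k []) D rD λ (m , worstD) →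
      mL≰mF (begin
        mL       ≡⟨ sym LRUJ≡mL ⟩
        LRU k J  ≡⟨ lru-cost (dedup-sameCost k J) [] ⟩
        LRU k D  ≤⟨ hyp D rD D (dedup-worstLRU k J J-worst) (dedup-noRepeat J) m worstD ⟩
        m        ≤⟨ dedup-worstFIFO≤ k J↭I worstD worstF ⟩
        mF       ∎)
  where
  open ≤-Reasoning
  D : List Page
  D = dedup J
  rD : Respects G D
  rD = dedup-respects J rJ
  J-worst : InW G (LRU k) I J
  J-worst = J↭I , rJ , λ J′ J′↭I rJ′ → subst (LRU k J′ ≤_) (sym LRUJ≡mL) (LRU≤mL J′ J′↭I rJ′)
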